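{- Let $\mu\in S_k$ be a pattern, and let $A,B$ be two $k$-element sets of positions with $|A\cap B|=r$, so that $|A\cup B|=2k-r$. Then the number of ways to assign the numbers $\{1,2,\dots,2k-r\}$ bijectively to the positions of $A\cup B$ such that the numbers in the positions of $A$ (read in increasing order of position) are in the same relative order as $\mu$, and likewise the numbers in the positions of $B$ are in the same relative order as $\mu$, is at most $2^{2k-2r}$.
   Context: A sequence of distinct numbers $(a_1,\dots,a_k)$ is in the same relative order as $\mu=\mu(1)\cdots\mu(k)\in S_k$ if for all $s,t$, $a_s<a_t$ exactly when $\mu(s)<\mu(t)$. -}

module Defs where

open import Data.Nat as ℕ using (ℕ; _≤_; _∸_; _*_; _^_)
open import Data.Fin as Fin using (Fin)
open import Data.Fin.Subset using (Subset; _∈_; _∪_; _∩_; ∣_∣)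
open import Data.Fin.Permutation using (Permutation′; _⟨$⟩ʳ_)
open import Data.Vec using (tabulate)
open import Data.Bool using (Bool)
open import Data.Product using (Σ; ∃; _×_; _,_)
open import Relation.Binary.PropositionalEquality using (_≡_; _≢_)
open import Relation.Nullary.Decidable using (⌊_⌋)
open import Data.Fin.Properties using (any?; _≟_)
open import Function.Bundles using (_⇔_)

-- A k-element set of positions inside Fin n, given by its listing in
-- increasing order of position: a strictly increasing map Fin k → Fin n.
StrictlyIncreasing : ∀ {k n} → (Fin k → Fin n) → Set
StrictlyIncreasing {k} a = ∀ (s t : Fin k) → s Fin.< t → a s Fin.< a t

image : ∀ {k n} → (Fin k → Fin n) → Subset n
image a = tabulate (λ i → ⌊ any? (λ s → a s ≟ i) ⌋)

SameRelOrder : ∀ {k n} → Permutation′ k → (Fin k → Fin n) → (Fin n → ℕ) → Set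
SameRelOrder {k} μ a f =
  ∀ (s t : Fin k) → (f (a s) ℕ.< f (a t)) ⇔ ((μ ⟨$⟩ʳ s) Fin.< (μ ⟨$⟩ʳ t))

BijectionOnto : ∀ {n} → Subset n → ℕ → (Fin n → ℕ) → Set
BijectionOnto {n} U m f =
    (∀ i → i ∈ U → 1 ≤ f i × f i ≤ m)
  × (∀ i j → i ∈ U → j ∈ U → f i ≡ f j → i ≡ j)
  × (∀ v → 1 ≤ v → v ≤ m → ∃ λ i → i ∈ U × f i ≡ v)

Valid : ∀ {k n} → ℕ → Permutation′ k → (Fin k → Fin n) → (Fin k → Fin n)
      → (Fin n → ℕ) → Set
Valid {k} r μ a b f =
    BijectionOnto (image a ∪ image b) (2 * k ∸ r) f
  × SameRelOrder μ a f
  × SameRelOrder μ b f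

-- Two assignments are different iff they differ at some position of A ∪ B
-- (values outside A ∪ B are irrelevant).
DifferOn : ∀ {n} → Subset n → (Fin n → ℕ) → (Fin n → ℕ) → Set
DifferOn U f g = ∃ λ i → i ∈ U × f i ≢ g i

-- Read the positions of A, and of B, in the order in which μ ranks them. A
-- valid assignment is then increasing along both lists, so the number 1 goes
-- to the head of one of them. If the two heads coincide this is forced;
-- otherwise there are two choices, and a head receiving 1 cannot occur later
-- in the other list, so it lies in A △ B. Deleting that position and lowering
-- the remaining numbers by one gives a recursion in which every binary choice
-- uses up an element of A △ B, which has 2k − 2r elements.
module Submission where

open import Defs
open import Data.Nat using (ℕ; _≤_; _∸_; _*_; _^_)
open import Data.Fin using (Fin)
open import Data.Fin.Subset using (_∩_; _∪_; ∣_∣)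
open import Data.Fin.Permutation using (Permutation′)
open import Data.List using (List; length)
open import Data.List.Relation.Unary.All using (All)
open import Data.List.Relation.Unary.AllPairs using (AllPairs)
open import Relation.Binary.PropositionalEquality using (_≡_)

open import Data.Bool.Properties using (T-≡)
open import Data.Empty using (⊥-elim)
open import Data.Fin as Fin using (zero; suc)
open import Data.Fin.Permutation using (_⟨$⟩ʳ_; _⟨$⟩ˡ_; inverseʳ; inverseˡ)
open import Data.Fin.Subset as S using (Subset; inside; outside)
import Data.Vec as Vec
import Data.Vec.Properties as Vec
open import Data.Vec using ([]; _∷_)
open import Data.Fin.Subset.Properties as SP using (x∈p∩q⁻; x∈p∪q⁻; x∈p∪q⁺; ∩-comm)
open import Data.List using ([]; _∷_; filter; tabulate; allFin)
open import Data.List.Membership.Propositional using (_∈_; _∉_)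
open import Data.List.Membership.Propositional.Properties using (∈-tabulate⁺; ∈-tabulate⁻; ∈-filter⁺; ∈-filter⁻)
open import Data.List.Properties using (filter-accept; filter-reject; length-removeAt′; length-tabulate)
open import Data.List.Relation.Unary.All as All using ([]; _∷_)
import Data.List.Relation.Unary.All.Properties as All
open import Data.List.Relation.Unary.AllPairs as AllPairs using ([]; _∷_)
import Data.List.Relation.Unary.AllPairs.Properties as AllPairs
open import Data.List.Relation.Unary.Any using (here; there; _─_)
open import Data.List.Relation.Unary.Unique.Propositional using (Unique)
import Data.List.Relation.Unary.Unique.Propositional.Properties as Unique
open import Data.Nat using (suc; _+_; _<_; z≤n; s≤s) renaming (_≟_ to _≟ℕ_)
open import Data.Nat.Properties
open import Data.Product using (∃; _×_; _,_; proj₁; proj₂; map₁; map₂)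
import Data.Sum as Sum
open import Data.Sum using (_⊎_; inj₁; inj₂; [_,_]; swap) renaming (map₂ to map₂-⊎)
open import Function using (id; _∘_; _$_; _⇔_; mk⇔)
open import Function.Bundles using (Equivalence)
open import Relation.Binary.Definitions using (DecidableEquality)
open import Relation.Binary.PropositionalEquality using (refl; sym; trans; cong; cong₂; subst; subst₂; _≢_; ≢-sym)
open import Relation.Nullary using (Dec; yes; no)
open import Relation.Nullary.Decidable using (fromWitness; toWitness)
open import Level using (0ℓ)
open import Relation.Unary using (Pred; Decidable)
open import Relation.Unary.Properties using (∁?)

module _ {A : Set} where

  length-filter-∁ : ∀ {P : Pred A 0ℓ} (P? : Decidable P) xs →
                    length (filter P? xs) + length (filter (∁? P?) xs) ≡ length xs
  length-filter-∁ P? [] = refl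
  length-filter-∁ P? (x ∷ xs) with P? x
  ... | yes _ = cong suc (length-filter-∁ P? xs)
  ... | no _ = trans (+-suc _ _) (cong suc (length-filter-∁ P? xs))

  AllPairs-mapWith : ∀ {P : Pred A 0ℓ} {R S : A → A → Set} {xs} →
                     (∀ {x y} → P x → P y → R x y → S x y) →
                     All P xs → AllPairs R xs → AllPairs S xs
  AllPairs-mapWith h [] [] = []
  AllPairs-mapWith h (px ∷ pxs) (rx ∷ rxs) =
    All.zipWith (λ (r , py) → h px py r) (rx , pxs) ∷ AllPairs-mapWith h pxs rxs

  ∈-─ : ∀ {x y} {ys : List A} → y ∈ ys → y ≢ x → (x∈ys : x ∈ ys) → y ∈ (ys ─ x∈ys)
  ∈-─ (here refl) y≢x (here refl) = ⊥-elim (y≢x refl)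
  ∈-─ (there y∈ys) y≢x (here refl) = y∈ys
  ∈-─ (here refl) y≢x (there x∈ys) = here refl
  ∈-─ (there y∈ys) y≢x (there x∈ys) = there (∈-─ y∈ys y≢x x∈ys)

  Unique-⊆⇒length≤ : ∀ {xs ys : List A} → Unique xs → (∀ {x} → x ∈ xs → x ∈ ys) →
                     length xs ≤ length ys
  Unique-⊆⇒length≤ [] _ = z≤n
  Unique-⊆⇒length≤ {x ∷ xs} {ys} (x≢xs ∷ xs!) xs⊆ys = begin
    suc (length xs)        ≤⟨ s≤s (Unique-⊆⇒length≤ xs! xs⊆ys─x) ⟩
    suc (length (ys ─ x∈ys)) ≡⟨ sym (length-removeAt′ ys _) ⟩
    length ys              ∎
    where
    open ≤-Reasoning
    x∈ys = xs⊆ys (here refl)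
    xs⊆ys─x : ∀ {y} → y ∈ xs → y ∈ (ys ─ x∈ys)
    xs⊆ys─x y∈xs = ∈-─ (xs⊆ys (there y∈xs)) (≢-sym (All.lookup x≢xs y∈xs)) x∈ys

module Labellings {P : Set} (_≟_ : DecidableEquality P) where

  open import Data.List.Membership.DecPropositional _≟_ using (_∈?_)

  _∖_ : List P → List P → List P
  X ∖ Y = filter (∁? (_∈? Y)) X

  ∣_△_∣ : List P → List P → ℕ
  ∣ X △ Y ∣ = length (X ∖ Y) + length (Y ∖ X)

  _∈⟨_,_⟩ : P → List P → List P → Set
  p ∈⟨ X , Y ⟩ = p ∈ X ⊎ p ∈ Y

  Increasing : (P → ℕ) → List P → Set
  Increasing f = AllPairs (λ p q → f p < f q)

  -- The state of the recursion once the numbers 1, …, c are placed and their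
  -- positions deleted.
  record Labelling (c d : ℕ) (X Y : List P) (f : P → ℕ) : Set where
    field
      increasingˡ : Increasing f X
      increasingʳ : Increasing f Y
      injective   : ∀ {p q} → p ∈⟨ X , Y ⟩ → q ∈⟨ X , Y ⟩ → f p ≡ f q → p ≡ q
      lower       : ∀ {p} → p ∈⟨ X , Y ⟩ → c < f p
      upper       : ∀ {p} → p ∈⟨ X , Y ⟩ → f p ≤ d
      surjective  : ∀ {v} → c < v → v ≤ d → ∃ λ p → p ∈⟨ X , Y ⟩ × f p ≡ v

  open Labelling

  Differ : List P → List P → (P → ℕ) → (P → ℕ) → Set
  Differ X Y f g = ∃ λ p → p ∈⟨ X , Y ⟩ × f p ≢ g p

  record Deletion (h : P) (X Y X′ Y′ : List P) : Set where
    field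
      deleted  : h ∈⟨ X , Y ⟩
      sound    : ∀ {p} → p ∈⟨ X′ , Y′ ⟩ → p ∈⟨ X , Y ⟩ × p ≢ h
      complete : ∀ {p} → p ∈⟨ X , Y ⟩ → p ≢ h → p ∈⟨ X′ , Y′ ⟩

  open Deletion

  private variable
    c d : ℕ
    h hx hy q : P
    X Y X′ Y′ T : List P
    f g : P → ℕ
    L : List (P → ℕ)

  ∖-length-antimonoʳ : ∀ X → (∀ {x} → x ∈ X → x ∈ Y → x ∈ Y′) →
                       length (X ∖ Y′) ≤ length (X ∖ Y)
  ∖-length-antimonoʳ [] _ = z≤n
  ∖-length-antimonoʳ {Y} {Y′} (x ∷ X) Y⊆Y′ with x ∈? Y | x ∈? Y′
  ... | yes _   | yes _   = ∖-length-antimonoʳ X (Y⊆Y′ ∘ there)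
  ... | no _    | yes _   = m≤n⇒m≤1+n (∖-length-antimonoʳ X (Y⊆Y′ ∘ there))
  ... | yes x∈Y | no x∉Y′ = ⊥-elim (x∉Y′ (Y⊆Y′ (here refl) x∈Y))
  ... | no _    | no _    = s≤s (∖-length-antimonoʳ X (Y⊆Y′ ∘ there))

  △-comm : ∀ X Y → ∣ X △ Y ∣ ≡ ∣ Y △ X ∣
  △-comm X Y = +-comm (length (X ∖ Y)) (length (Y ∖ X))

  △-∷-∉ : ∀ X Y → hx ∉ Y → suc ∣ X △ Y ∣ ≤ ∣ hx ∷ X △ Y ∣
  △-∷-∉ {hx} X Y hx∉Y = begin
    suc (length (X ∖ Y) + length (Y ∖ X))        ≤⟨ s≤s (+-monoʳ-≤ _ (∖-length-antimonoʳ Y Y∩hx∷X⊆X)) ⟩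
    suc (length (X ∖ Y)) + length (Y ∖ (hx ∷ X)) ≡⟨ cong (λ Z → length Z + length (Y ∖ (hx ∷ X))) hx∷X∖Y ⟩
    ∣ hx ∷ X △ Y ∣                              ∎
    where
    open ≤-Reasoning
    hx∷X∖Y : hx ∷ (X ∖ Y) ≡ (hx ∷ X) ∖ Y
    hx∷X∖Y = sym (filter-accept (∁? (_∈? Y)) hx∉Y)
    Y∩hx∷X⊆X : ∀ {y} → y ∈ Y → y ∈ hx ∷ X → y ∈ X
    Y∩hx∷X⊆X y∈Y (here refl) = ⊥-elim (hx∉Y y∈Y)
    Y∩hx∷X⊆X _   (there y∈X) = y∈X

  △-∷-∷ : ∀ X Y → h ∉ X → h ∉ Y → ∣ X △ Y ∣ ≤ ∣ h ∷ X △ h ∷ Y ∣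
  △-∷-∷ {h} X Y h∉X h∉Y = begin
    ∣ X △ Y ∣                                   ≤⟨ +-mono-≤ (∖-length-antimonoʳ X (drop-h h∉X))
                                                                (∖-length-antimonoʳ Y (drop-h h∉Y)) ⟩
    length (X ∖ (h ∷ Y)) + length (Y ∖ (h ∷ X))  ≡⟨ sym (cong₂ _+_ (reject-h X Y) (reject-h Y X)) ⟩
    ∣ h ∷ X △ h ∷ Y ∣                                ∎
    where
    open ≤-Reasoning
    reject-h : ∀ Z W → length ((h ∷ Z) ∖ (h ∷ W)) ≡ length (Z ∖ (h ∷ W))
    reject-h Z W = cong length (filter-reject (∁? (_∈? (h ∷ W))) {xs = Z} (_$ here refl))
    drop-h : ∀ {Z W x} → h ∉ Z → x ∈ Z → x ∈ h ∷ W → x ∈ W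
    drop-h h∉Z x∈Z (here refl) = ⊥-elim (h∉Z x∈Z)
    drop-h _   _   (there x∈W) = x∈W

  ∖-length≤ : ∀ {Z} X Y → Unique Z → (∀ {x} → x ∈ Z → x ∈ X × x ∈ Y) →
              length (X ∖ Y) ≤ length X ∸ length Z
  ∖-length≤ {Z} X Y Z! Z⊆X∩Y = begin
    length (X ∖ Y)                            ≡⟨ sym (m+n∸m≡n (length X∩Y) _) ⟩
    length X∩Y + length (X ∖ Y) ∸ length X∩Y  ≡⟨ cong (_∸ length X∩Y) (length-filter-∁ (_∈? Y) X) ⟩
    length X ∸ length X∩Y                     ≤⟨ ∸-monoʳ-≤ (length X) (Unique-⊆⇒length≤ Z! Z⊆X∩Y′) ⟩
    length X ∸ length Z                       ∎
    where
    open ≤-Reasoning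
    X∩Y = filter (_∈? Y) X
    Z⊆X∩Y′ : ∀ {x} → x ∈ Z → x ∈ X∩Y
    Z⊆X∩Y′ x∈Z = let x∈X , x∈Y = Z⊆X∩Y x∈Z in ∈-filter⁺ (_∈? Y) x∈X x∈Y

  labelling-swap : Labelling c d X Y f → Labelling c d Y X f
  labelling-swap ℓ = record
    { increasingˡ = increasingʳ ℓ
    ; increasingʳ = increasingˡ ℓ
    ; injective   = λ p∈ q∈ → injective ℓ (swap p∈) (swap q∈)
    ; lower       = lower ℓ ∘ swap
    ; upper       = upper ℓ ∘ swap
    ; surjective  = λ c<v v≤d → map₂ (map₁ swap) (surjective ℓ c<v v≤d)
    }

  differ-swap : Differ X Y f g → Differ Y X f g
  differ-swap = map₂ (map₁ swap)

  head∉tail : Increasing f (h ∷ T) → h ∉ T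
  head∉tail (h<T ∷ _) h∈T = <-irrefl refl (All.lookup h<T h∈T)

  increasing-least-at-head : Increasing f (h ∷ T) → c < f h → q ∈ h ∷ T → f q ≡ suc c → f h ≡ suc c
  increasing-least-at-head _ _ (here refl) fq≡1+c = fq≡1+c
  increasing-least-at-head {f} {h} (h<T ∷ _) c<fh (there q∈T) fq≡1+c =
    ⊥-elim (<⇒≱ (subst (f h <_) fq≡1+c (All.lookup h<T q∈T)) c<fh)

  least-label-exists : Labelling c d X Y f → q ∈⟨ X , Y ⟩ → ∃ λ p → p ∈⟨ X , Y ⟩ × f p ≡ suc c
  least-label-exists ℓ q∈ = surjective ℓ ≤-refl (≤-trans (lower ℓ q∈) (upper ℓ q∈))

  least-at-a-head : Labelling c d (hx ∷ X) Y f → f hx ≡ suc c ⊎ ∃ λ q → q ∈ Y × f q ≡ suc c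
  least-at-a-head ℓ with least-label-exists ℓ (inj₁ (here refl))
  ... | q , inj₁ q∈X , fq≡1+c =
    inj₁ (increasing-least-at-head (increasingˡ ℓ) (lower ℓ (inj₁ (here refl))) q∈X fq≡1+c)
  ... | q , inj₂ q∈Y , fq≡1+c = inj₂ (q , q∈Y , fq≡1+c)

  least-at-heads : Labelling c d (hx ∷ X) (hy ∷ Y) f → f hx ≡ suc c ⊎ f hy ≡ suc c
  least-at-heads ℓ = map₂-⊎ (λ (q , q∈ , fq≡1+c) →
    increasing-least-at-head (increasingʳ ℓ) (lower ℓ (inj₂ (here refl))) q∈ fq≡1+c) (least-at-a-head ℓ)

  least-head-fresh : Labelling c d (hx ∷ X) (hy ∷ Y) f → hx ≢ hy → f hx ≡ suc c → hx ∉ hy ∷ Y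
  least-head-fresh ℓ hx≢hy fhx≡1+c hx∈ =
    hx≢hy (injective ℓ (inj₁ (here refl)) (inj₂ (here refl)) (trans fhx≡1+c (sym fhy≡1+c)))
    where fhy≡1+c = increasing-least-at-head (increasingʳ ℓ) (lower ℓ (inj₂ (here refl))) hx∈ fhx≡1+c

  deletion-head : hx ∉ X → hx ∉ Y → Deletion hx (hx ∷ X) Y X Y
  deletion-head hx∉X hx∉Y = record
    { deleted  = inj₁ (here refl)
    ; sound    = λ { (inj₁ p∈X) → inj₁ (there p∈X) , λ { refl → hx∉X p∈X }
                   ; (inj₂ p∈Y) → inj₂ p∈Y , λ { refl → hx∉Y p∈Y } }
    ; complete = λ { (inj₁ (here refl)) p≢hx → ⊥-elim (p≢hx refl)
                   ; (inj₁ (there p∈X)) _ → inj₁ p∈X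
                   ; (inj₂ p∈Y) _ → inj₂ p∈Y }
    }

  deletion-common : h ∉ X → h ∉ Y → Deletion h (h ∷ X) (h ∷ Y) X Y
  deletion-common h∉X h∉Y = record
    { deleted  = inj₁ (here refl)
    ; sound    = λ { (inj₁ p∈X) → inj₁ (there p∈X) , λ { refl → h∉X p∈X }
                   ; (inj₂ p∈Y) → inj₂ (there p∈Y) , λ { refl → h∉Y p∈Y } }
    ; complete = λ { (inj₁ (here refl)) p≢h → ⊥-elim (p≢h refl)
                   ; (inj₁ (there p∈X)) _ → inj₁ p∈X
                   ; (inj₂ (here refl)) p≢h → ⊥-elim (p≢h refl)
                   ; (inj₂ (there p∈Y)) _ → inj₂ p∈Y }
    }

  labelling-delete : Deletion h X Y X′ Y′ → Increasing f X′ → Increasing f Y′ → f h ≡ suc c →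
                     Labelling c d X Y f → Labelling (suc c) d X′ Y′ f
  labelling-delete {h} {f = f} {c} del incX′ incY′ fh≡1+c ℓ = record
    { increasingˡ = incX′
    ; increasingʳ = incY′
    ; injective   = λ p∈ q∈ → injective ℓ (proj₁ (sound del p∈)) (proj₁ (sound del q∈))
    ; lower       = λ p∈ → let p∈₀ , p≢h = sound del p∈ in
                      ≤∧≢⇒< (lower ℓ p∈₀) λ 1+c≡fp →
                        p≢h (injective ℓ p∈₀ (deleted del) (trans (sym 1+c≡fp) (sym fh≡1+c)))
    ; upper       = upper ℓ ∘ proj₁ ∘ sound del
    ; surjective  = λ 1+c<v v≤d → let p , p∈ , fp≡v = surjective ℓ (<⇒≤ 1+c<v) v≤d in
                      p , complete del p∈ (λ { refl → <-irrefl (trans (sym fh≡1+c) fp≡v) 1+c<v }) , fp≡v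
    }

  differ-delete : Deletion h X Y X′ Y′ → f h ≡ g h → Differ X Y f g → Differ X′ Y′ f g
  differ-delete del fh≡gh (p , p∈ , fp≢gp) = p , complete del p∈ (λ { refl → fp≢gp fh≡gh }) , fp≢gp

  LabellingsBound : List P → List P → Set
  LabellingsBound X Y = ∀ {c d L} → All (Labelling c d X Y) L → AllPairs (Differ X Y) L →
                        length L ≤ 2 ^ ∣ X △ Y ∣

  labellings-bound-swap : LabellingsBound X Y → LabellingsBound Y X
  labellings-bound-swap {X} {Y} bound ℓs ds =
    ≤-trans (bound (All.map labelling-swap ℓs) (AllPairs.map differ-swap ds))
            (≤-reflexive (cong (2 ^_) (△-comm X Y)))

  labellings-bound-[] : LabellingsBound [] []
  labellings-bound-[] _ []                                 = z≤n
  labellings-bound-[] _ (_ ∷ [])                           = s≤s z≤n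
  labellings-bound-[] _ (((_ , inj₁ () , _) ∷ _) ∷ _)
  labellings-bound-[] _ (((_ , inj₂ () , _) ∷ _) ∷ _)

  -- The factor 2 stands for the second branch of the choice at the heads.
  least-head-bound : LabellingsBound X Y → All (Labelling c d (hx ∷ X) Y) L → All (λ f → f hx ≡ suc c) L →
                     All (λ _ → hx ∉ Y) L → AllPairs (Differ (hx ∷ X) Y) L →
                     2 * length L ≤ 2 ^ ∣ hx ∷ X △ Y ∣
  least-head-bound {L = []} _ _ _ _ _ = z≤n
  least-head-bound {X} {Y} {hx = hx} {L = f ∷ L} bound ℓs pins (hx∉Y ∷ _) ds = begin
    2 * length (f ∷ L)     ≤⟨ *-monoʳ-≤ 2 (bound ℓs′ ds′) ⟩
    2 ^ suc ∣ X △ Y ∣      ≤⟨ ^-monoʳ-≤ 2 (△-∷-∉ X Y hx∉Y) ⟩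
    2 ^ ∣ hx ∷ X △ Y ∣     ∎
    where
    open ≤-Reasoning
    del = deletion-head (head∉tail (increasingˡ (All.head ℓs))) hx∉Y
    ℓs′ = All.zipWith (λ (ℓ , fhx≡1+c) →
            labelling-delete del (AllPairs.tail (increasingˡ ℓ)) (increasingʳ ℓ) fhx≡1+c ℓ) (ℓs , pins)
    ds′ = AllPairs-mapWith (λ fhx gh dfg → differ-delete del (trans fhx (sym gh)) dfg) pins ds

  labellings-bound-one-sided : LabellingsBound X [] → LabellingsBound (hx ∷ X) []
  labellings-bound-one-sided bound {L = L} ℓs ds =
    ≤-trans (m≤m+n (length L) _)
      (least-head-bound bound ℓs (All.map (λ ℓ → [ id , (λ { (_ , () , _) }) ] (least-at-a-head ℓ)) ℓs)
        (All.map (λ _ ()) ℓs) ds)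

  labellings-bound-common : LabellingsBound X Y → LabellingsBound (h ∷ X) (h ∷ Y)
  labellings-bound-common _ {L = []} _ _ = z≤n
  labellings-bound-common {X} {Y} {h} bound ℓs@(ℓ ∷ _) ds = begin
    _                      ≤⟨ bound ℓs′ ds′ ⟩
    2 ^ ∣ X △ Y ∣          ≤⟨ ^-monoʳ-≤ 2 (△-∷-∷ X Y h∉X h∉Y) ⟩
    2 ^ ∣ h ∷ X △ h ∷ Y ∣  ∎
    where
    open ≤-Reasoning
    h∉X = head∉tail (increasingˡ ℓ)
    h∉Y = head∉tail (increasingʳ ℓ)
    del = deletion-common h∉X h∉Y
    pins = All.map (λ ℓ → [ id , id ] (least-at-heads ℓ)) ℓs
    ℓs′ = All.zipWith (λ (ℓ , fh≡1+c) →
            labelling-delete del (AllPairs.tail (increasingˡ ℓ)) (AllPairs.tail (increasingʳ ℓ)) fh≡1+c ℓ) (ℓs , pins)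
    ds′ = AllPairs-mapWith (λ fh gh dfg → differ-delete del (trans fh (sym gh)) dfg) pins ds

  labellings-bound-distinct : hx ≢ hy → LabellingsBound X (hy ∷ Y) → LabellingsBound (hx ∷ X) Y →
                              LabellingsBound (hx ∷ X) (hy ∷ Y)
  labellings-bound-distinct {hx} {hy} {X} {Y} hx≢hy boundˣ boundʸ {c} {L = L} ℓs ds = *-cancelˡ-≤ 2 (begin
    2 * length L                   ≡⟨ cong (2 *_) (sym (length-filter-∁ least-at-hx? L)) ⟩
    2 * (length Lˣ + length Lʸ)    ≡⟨ *-distribˡ-+ 2 (length Lˣ) (length Lʸ) ⟩
    2 * length Lˣ + 2 * length Lʸ  ≤⟨ +-mono-≤ countˣ countʸ ⟩
    2 ^ e + 2 ^ e                  ≡⟨ cong (2 ^ e +_) (sym (+-identityʳ (2 ^ e))) ⟩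
    2 * 2 ^ e                      ∎)
    where
    open ≤-Reasoning
    e = ∣ hx ∷ X △ hy ∷ Y ∣
    least-at-hx? = λ f → f hx ≟ℕ suc c
    Lˣ = filter least-at-hx? L
    Lʸ = filter (∁? least-at-hx?) L
    ℓsˣ = All.filter⁺ least-at-hx? ℓs
    ℓsʸ = All.filter⁺ (∁? least-at-hx?) ℓs
    pinsˣ = All.all-filter least-at-hx? L
    pinsʸ = All.zipWith (λ (ℓ , fhx≢1+c) → [ (λ fhx≡1+c → ⊥-elim (fhx≢1+c fhx≡1+c)) , id ] (least-at-heads ℓ))
              (ℓsʸ , All.all-filter (∁? least-at-hx?) L)
    countˣ = least-head-bound boundˣ ℓsˣ pinsˣ
      (All.zipWith (λ (ℓ , fhx≡1+c) → least-head-fresh ℓ hx≢hy fhx≡1+c) (ℓsˣ , pinsˣ))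
      (AllPairs.filter⁺ least-at-hx? ds)
    countʸ = ≤-trans (least-head-bound (labellings-bound-swap boundʸ) (All.map labelling-swap ℓsʸ) pinsʸ
      (All.zipWith (λ (ℓ , fhy≡1+c) → least-head-fresh (labelling-swap ℓ) (≢-sym hx≢hy) fhy≡1+c) (ℓsʸ , pinsʸ))
      (AllPairs.map differ-swap (AllPairs.filter⁺ (∁? least-at-hx?) ds)))
      (≤-reflexive (cong (2 ^_) (△-comm (hy ∷ Y) (hx ∷ X))))

  labellings-bound-heads : Dec (hx ≡ hy) → LabellingsBound X Y → LabellingsBound X (hy ∷ Y) →
                           LabellingsBound (hx ∷ X) Y → LabellingsBound (hx ∷ X) (hy ∷ Y)
  labellings-bound-heads (yes refl)  bound _      _      = labellings-bound-common bound
  labellings-bound-heads (no hx≢hy) _     boundˣ boundʸ = labellings-bound-distinct hx≢hy boundˣ boundʸ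

  labellings-bound-[]ʳ : ∀ X → LabellingsBound X []
  labellings-bound-[]ʳ []       = labellings-bound-[]
  labellings-bound-[]ʳ (hx ∷ X) = labellings-bound-one-sided (labellings-bound-[]ʳ X)

  labellings-bound : ∀ X Y → LabellingsBound X Y
  labellings-bound X        []       = labellings-bound-[]ʳ X
  labellings-bound []       Y        = labellings-bound-swap (labellings-bound-[]ʳ Y)
  labellings-bound (hx ∷ X) (hy ∷ Y) =
    labellings-bound-heads (hx ≟ hy) (labellings-bound X Y) (labellings-bound X (hy ∷ Y)) (labellings-bound (hx ∷ X) Y)

open module FinLabellings {n} = Labellings (Fin._≟_ {n})

elements : ∀ {n} → Subset n → List (Fin n)
elements {n} p = filter (SP._∈? p) (allFin n)

⇔∈-tail : ∀ {n} {B : Fin (suc n) → Set} {x} {p : Subset n} →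
           (∀ i → B i ⇔ i S.∈ x ∷ p) → ∀ i → B (suc i) ⇔ i S.∈ p
⇔∈-tail B⇔∈ i = mk⇔ (SP.drop-there ∘ Equivalence.to (B⇔∈ (suc i))) (Equivalence.from (B⇔∈ (suc i)) ∘ Vec.there)

∣p∣≡length-filter-tabulate : ∀ {n} {A : Set} {Q : Pred A 0ℓ} (Q? : Decidable Q) (f : Fin n → A) (p : Subset n) →
                             (∀ i → Q (f i) ⇔ i S.∈ p) → ∣ p ∣ ≡ length (filter Q? (tabulate f))
∣p∣≡length-filter-tabulate Q? f [] _ = refl
∣p∣≡length-filter-tabulate Q? f (x ∷ p) Q⇔∈ with Q? (f zero)
... | yes Qf₀ with Equivalence.to (Q⇔∈ zero) Qf₀
...   | Vec.here = cong suc (∣p∣≡length-filter-tabulate Q? (f ∘ suc) p (⇔∈-tail Q⇔∈))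
∣p∣≡length-filter-tabulate Q? f (inside ∷ p) Q⇔∈ | no ¬Qf₀ = ⊥-elim (¬Qf₀ (Equivalence.from (Q⇔∈ zero) Vec.here))
∣p∣≡length-filter-tabulate Q? f (outside ∷ p) Q⇔∈ | no _ = ∣p∣≡length-filter-tabulate Q? (f ∘ suc) p (⇔∈-tail Q⇔∈)

∣p∣≡length-elements : ∀ {n} (p : Subset n) → ∣ p ∣ ≡ length (elements p)
∣p∣≡length-elements p = ∣p∣≡length-filter-tabulate (SP._∈? p) id p (λ _ → mk⇔ id id)

module _ {k n : ℕ} where

  ∈-image⁺ : ∀ (a : Fin k → Fin n) s → a s S.∈ image a
  ∈-image⁺ a s = Vec.lookup⇒[]= (a s) (image a)
    (trans (Vec.lookup∘tabulate _ (a s)) (Equivalence.to T-≡ (fromWitness (s , refl))))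

  ∈-image⁻ : ∀ (a : Fin k → Fin n) {i} → i S.∈ image a → ∃ λ s → a s ≡ i
  ∈-image⁻ a {i} i∈a = toWitness (Equivalence.from T-≡
    (trans (sym (Vec.lookup∘tabulate _ i)) (Vec.[]=⇒lookup i∈a)))

  -- a s is placed at index μ s, so a labelling in the relative order of μ
  -- increases along the list.
  listing : Permutation′ k → (Fin k → Fin n) → List (Fin n)
  listing μ a = tabulate (λ j → a (μ ⟨$⟩ˡ j))

  ∈-listing⁺ : ∀ μ a {i} → i S.∈ image a → i ∈ listing μ a
  ∈-listing⁺ μ a i∈a with ∈-image⁻ a i∈a
  ... | s , refl = subst (λ t → a t ∈ listing μ a) (inverseˡ μ) (∈-tabulate⁺ (μ ⟨$⟩ʳ s))

  ∈-listing⁻ : ∀ μ a {i} → i ∈ listing μ a → i S.∈ image a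
  ∈-listing⁻ μ a i∈ with ∈-tabulate⁻ i∈
  ... | j , refl = ∈-image⁺ a (μ ⟨$⟩ˡ j)

  listing-increasing : ∀ μ a {f} → SameRelOrder μ a f → Increasing f (listing μ a)
  listing-increasing μ a sro = AllPairs.tabulate⁺-< λ {i} {j} i<j →
    Equivalence.from (sro (μ ⟨$⟩ˡ i) (μ ⟨$⟩ˡ j)) (subst₂ Fin._<_ (sym (inverseʳ μ)) (sym (inverseʳ μ)) i<j)

  module _ (μ : Permutation′ k) (a b : Fin k → Fin n) where

    ∈-image-∪⇒∈-listings : ∀ {i} → i S.∈ image a ∪ image b → i ∈⟨ listing μ a , listing μ b ⟩
    ∈-image-∪⇒∈-listings i∈ = Sum.map (∈-listing⁺ μ a) (∈-listing⁺ μ b) (x∈p∪q⁻ _ _ i∈)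

    ∈-listings⇒∈-image-∪ : ∀ {i} → i ∈⟨ listing μ a , listing μ b ⟩ → i S.∈ image a ∪ image b
    ∈-listings⇒∈-image-∪ i∈ = x∈p∪q⁺ (Sum.map (∈-listing⁻ μ a) (∈-listing⁻ μ b) i∈)

    valid⇒labelling : ∀ {r f} → Valid r μ a b f → Labelling 0 (2 * k ∸ r) (listing μ a) (listing μ b) f
    valid⇒labelling ((range , injective , surjective) , sroᵃ , sroᵇ) = record
      { increasingˡ = listing-increasing μ a sroᵃ
      ; increasingʳ = listing-increasing μ b sroᵇ
      ; injective   = λ p∈ q∈ → injective _ _ (∈-listings⇒∈-image-∪ p∈) (∈-listings⇒∈-image-∪ q∈)
      ; lower       = proj₁ ∘ range _ ∘ ∈-listings⇒∈-image-∪
      ; upper       = proj₂ ∘ range _ ∘ ∈-listings⇒∈-image-∪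
      ; surjective  = λ 0<v v≤d → let i , i∈ , fi≡v = surjective _ 0<v v≤d in i , ∈-image-∪⇒∈-listings i∈ , fi≡v
      }

    differOn⇒differ : ∀ {f g} → DifferOn (image a ∪ image b) f g → Differ (listing μ a) (listing μ b) f g
    differOn⇒differ (i , i∈ , fi≢gi) = i , ∈-image-∪⇒∈-listings i∈ , fi≢gi

    listing-∖-length≤ : length (listing μ a ∖ listing μ b) ≤ k ∸ ∣ image a ∩ image b ∣
    listing-∖-length≤ = begin
      length (A ∖ B)                  ≤⟨ ∖-length≤ A B common! common⊆ ⟩
      length A ∸ length (elements C)  ≡⟨ cong₂ _∸_ (length-tabulate _) (sym (∣p∣≡length-elements C)) ⟩
      k ∸ ∣ C ∣                       ∎
      where
      open ≤-Reasoning
      A = listing μ a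
      B = listing μ b
      C = image a ∩ image b
      common! = Unique.filter⁺ (SP._∈? C) (Unique.allFin⁺ n)
      common⊆ : ∀ {i} → i ∈ elements C → i ∈ A × i ∈ B
      common⊆ i∈ = let i∈a , i∈b = x∈p∩q⁻ _ _ (proj₂ (∈-filter⁻ (SP._∈? C) {xs = allFin n} i∈)) in
                   ∈-listing⁺ μ a i∈a , ∈-listing⁺ μ b i∈b

-- The positions need not be increasing: only their ranks under μ matter.
lemma2p1 : ∀ (k r n : ℕ) (μ : Permutation′ k) (a b : Fin k → Fin n)
           → StrictlyIncreasing a → StrictlyIncreasing b
           → ∣ image a ∩ image b ∣ ≡ r
           → (L : List (Fin n → ℕ))
           → All (Valid r μ a b) L
           → AllPairs (DifferOn (image a ∪ image b)) L
           → length L ≤ 2 ^ (2 * k ∸ 2 * r)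
lemma2p1 k r n μ a b _ _ refl L valid distinct = begin
  length L                                          ≤⟨ labellings-bound A B (All.map (valid⇒labelling μ a b {r}) valid)
                                                                            (AllPairs.map (differOn⇒differ μ a b) distinct) ⟩
  2 ^ ∣ A △ B ∣                                     ≤⟨ ^-monoʳ-≤ 2 (+-mono-≤ (listing-∖-length≤ μ a b) B∖A≤) ⟩
  2 ^ ((k ∸ r) + (k ∸ r))                           ≡⟨ cong (λ m → 2 ^ (k ∸ r + m)) (sym (+-identityʳ (k ∸ r))) ⟩
  2 ^ (2 * (k ∸ r))                                 ≡⟨ cong (2 ^_) (*-distribˡ-∸ 2 k r) ⟩
  2 ^ (2 * k ∸ 2 * r)                               ∎
  where
  open ≤-Reasoning
  A = listing μ a
  B = listing μ b
  B∖A≤ : length (B ∖ A) ≤ k ∸ r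
  B∖A≤ = subst (λ m → length (B ∖ A) ≤ k ∸ m) (cong ∣_∣ (∩-comm (image b) (image a))) (listing-∖-length≤ μ b a)
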